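{- Let $p$ and $q$ be prime numbers with $q=p+2$, and let $C$ be the curve $y^2=-x^4+2(p+q)x^2-4$. Then: (1) $C(\mathbf{Q}_p)\neq\emptyset$ if and only if $(-1/p)=1$, i.e. $p\equiv1\pmod 4$. (2) $C(\mathbf{Q}_q)\neq\emptyset$ if and only if $(-1/q)=1$, i.e. $q\equiv1\pmod 4$.
   Context: $C(\mathbf{Q}_v)$ denotes the set of points $(x,y)\in\mathbf{Q}_v^2$ satisfying the equation, where $\mathbf{Q}_v$ is the completion of $\mathbf{Q}$ at $v$; $(\cdot/\cdot)$ is the Legendre symbol. -}

module Defs where

open import Data.Nat as ℕ using (ℕ; suc; _^_)
open import Data.Nat.Primality using (Prime)
open import Data.Integer as ℤ using (ℤ; +_; -_; _+_; _-_; _*_)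
open import Data.Integer.Divisibility using (_∣_)
open import Data.Product using (Σ; ∃; ∃-syntax; _×_; _,_)

-- ℤ_p as the inverse limit of ℤ/p^n ℤ: a p-adic integer is a sequence
-- (a n)_n of integers with a (n+1) ≡ a n (mod p^n); a n represents its
-- residue mod p^n.  Ring operations on ℤ_p are componentwise on residues,
-- and two p-adic integers are equal iff all residues agree mod p^n.
IsCoherent : ℕ → (ℕ → ℤ) → Set
IsCoherent p a = ∀ n → (+ (p ℕ.^ n)) ∣ (a (suc n) - a n)

record ℤₚ (p : ℕ) : Set where
  constructor mkℤₚ
  field
    seq : ℕ → ℤ
    coherent : IsCoherent p seq
open ℤₚ public

infixr 8 _^ᶻ_
_^ᶻ_ : ℤ → ℕ → ℤ
x ^ᶻ ℕ.zero = + 1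
x ^ᶻ suc k = x * (x ^ᶻ k)

-- Every element of ℚ_v is X / v^a with X ∈ ℤ_v, a ∈ ℕ.  With
-- x = X / v^a, y = Y / v^b, multiplying the equation by v^(4a+2b)
-- (a unit of ℚ_v) gives the equivalent ℤ_v-equation
--   Y^2 v^(4a) = - X^4 v^(2b) + 2(p+q) X^2 v^(2a+2b) - 4 v^(4a+2b).
curveDefect : (p q v a b : ℕ) → ℤ → ℤ → ℤ
curveDefect p q v a b X Y =
  (Y ^ᶻ 2) * ((+ v) ^ᶻ (4 ℕ.* a))
  - ( - ((X ^ᶻ 4) * ((+ v) ^ᶻ (2 ℕ.* b)))
      + (+ (2 ℕ.* (p ℕ.+ q))) * (X ^ᶻ 2) * ((+ v) ^ᶻ (2 ℕ.* a ℕ.+ 2 ℕ.* b))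
      - (+ 4) * ((+ v) ^ᶻ (4 ℕ.* a ℕ.+ 2 ℕ.* b)) )

CurveHasQvPoint : (p q v : ℕ) → Set
CurveHasQvPoint p q v =
  ∃[ X ] ∃[ Y ] ∃[ a ] ∃[ b ]
    (∀ n → (+ (v ℕ.^ n)) ∣ curveDefect p q v a b (seq {v} X n) (seq {v} Y n))

LegendreMinusOneIsOne : ℕ → Set
LegendreMinusOneIsOne ℓ = ∃[ x ] (+ ℓ) ∣ (x * x + + 1)

-- Let v be p or q.  Since q = p + 2, the coefficient 2(p + q) equals 4v + 4ε with ε = ±1,
-- and the curve becomes y² + (x² - 2ε)² = 4v x².  If -1 is a square modulo v, Hensel's
-- lemma lifts it to a square root i of -1 in ℤ_v, and (0, 2i) is a point.  Conversely,
-- clearing the denominators of a point gives A² + B² ≡ 4v C² modulo every power of v; if -1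
-- is not a square modulo v, then v ∣ A² + B² forces v ∣ A, B, hence v ∣ C, and descending
-- far enough contradicts the denominators.  Finally -1 is a square modulo an odd prime
-- ℓ = 2m + 1 iff m is even: for odd m, Fermat gives 1 ≡ x^(2m) ≡ (-1)^m; for m = 2K,
-- X^(m+1) - X has at most m + 1 roots modulo ℓ, so some x has x^m ≡ -1 and (x^K)² ≡ -1.
module Submission where

open import Defs
open import Data.Nat as ℕ using (ℕ; zero; suc; _!; _%_)
import Data.Nat.Properties as ℕ
open import Data.Nat.Properties using (_!*_!≢0)
import Data.Nat.Divisibility as ℕ
open import Data.Nat.Combinatorics using (_C_; nCk≡n!/k![n-k]!; k![n∸k]!∣n!; nCn≡1)
open import Data.Nat.DivMod using (m/n*n≡m; [m+kn]%n≡m%n)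
open import Data.Nat.Primality
  using (Prime; euclidsLemma; prime⇒nonZero; prime⇒irreducible; prime⇒¬composite; composite[4]; ¬prime[0]; ¬prime[1])
open import Data.Integer as ℤ using (ℤ; +_; _+_; _-_; _*_; -_; _^_; NonZero)
import Data.Integer.Properties as ℤ
import Data.Integer.DivMod as ℤ
import Data.Integer.Divisibility as Unsigned
open import Data.Integer.Divisibility.Signed
open import Data.Integer.Tactic.RingSolver using (solve-∀)
import Data.Nat.Tactic.RingSolver as ℕ-Solver
open import Data.Fin as Fin using (toℕ; inject₁; fromℕ)
open import Data.Fin.Properties using (toℕ-inject₁; toℕ-fromℕ; toℕ<n)
open import Data.Vec.Functional using (Vector; init; tail)
open import Data.Vec using (Vec; []; _∷_; replicate)
open import Data.List using (List; _∷_; length; applyUpTo)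
open import Data.List.Properties using (length-applyUpTo)
open import Data.List.Relation.Unary.All as All using (All; []; _∷_)
open import Data.List.Relation.Unary.Any using (satisfied)
open import Data.List.Relation.Unary.AllPairs using (AllPairs; []; _∷_)
open import Data.List.Relation.Unary.AllPairs.Properties using (applyUpTo⁺₁)
open import Algebra.Bundles using (CommutativeSemiring)
open import Algebra.Properties.CommutativeSemiring.Binomial ℕ.+-*-commutativeSemiring as Binomial
  using (binomialTerm)
open import Algebra.Properties.Semiring.Exp (CommutativeSemiring.semiring ℕ.+-*-commutativeSemiring) as SemiringExp using ()
open import Algebra.Properties.Monoid.Sum ℕ.+-0-monoid using (sum; sum-init-last)
open import Algebra.Properties.Monoid.Mult ℕ.+-0-monoid as MonoidMult using ()
open import Data.Sum as Sum using (_⊎_; inj₁; inj₂)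
open import Data.Product using (∃-syntax; _×_; _,_; proj₁; proj₂; map₂)
open import Data.Empty using (⊥-elim)
open import Function using (id; _∘_; _⇔_; mk⇔)
open import Relation.Nullary using (¬_; yes; no)
open import Relation.Binary.PropositionalEquality

private
  variable
    d n p ℓ : ℕ
    i j x : ℤ

pos-^ : ∀ m n → + (m ℕ.^ n) ≡ (+ m) ^ n
pos-^ m zero    = refl
pos-^ m (suc n) = trans (ℤ.pos-* m (m ℕ.^ n)) (cong (+ m *_) (pos-^ m n))

^-distribʳ-* : ∀ x y n → (x * y) ^ n ≡ x ^ n * y ^ n
^-distribʳ-* x y zero    = refl
^-distribʳ-* x y (suc n) = trans (cong (x * y *_) (^-distribʳ-* x y n)) (shuffle x y (x ^ n) (y ^ n))
  where
  shuffle : ∀ x y X Y → x * y * (X * Y) ≡ x * X * (y * Y)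
  shuffle = solve-∀

^-nonZero : ∀ x n .{{_ : NonZero x}} → NonZero (x ^ n)
^-nonZero x zero    = _
^-nonZero x (suc n) {{x≢0}} = ℤ.i*j≢0 x (x ^ n) {{x≢0}} {{^-nonZero x n}}

∣ᵤ⇒∣-^ : ∀ d n → + (d ℕ.^ n) Unsigned.∣ x → (+ d) ^ n ∣ x
∣ᵤ⇒∣-^ d n dⁿ∣x = subst (_∣ _) (pos-^ d n) (∣ᵤ⇒∣ dⁿ∣x)

∣⇒∣ᵤ-^ : ∀ d n → (+ d) ^ n ∣ x → + (d ℕ.^ n) Unsigned.∣ x
∣⇒∣ᵤ-^ d n dⁿ∣x = ∣⇒∣ᵤ (subst (_∣ _) (sym (pos-^ d n)) dⁿ∣x)

x-y∣xⁿ-yⁿ : ∀ x y n → x - y ∣ x ^ n - y ^ n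
x-y∣xⁿ-yⁿ x y zero    = divides (+ 0) refl
x-y∣xⁿ-yⁿ x y (suc n) =
  subst (x - y ∣_) (split x y (x ^ n) (y ^ n))
    (∣m∣n⇒∣m+n (∣m⇒∣m*n (x ^ n) ∣-refl) (∣n⇒∣m*n y (x-y∣xⁿ-yⁿ x y n)))
  where
  split : ∀ x y X Y → (x - y) * X + y * (X - Y) ≡ x * X - y * Y
  split = solve-∀

even⊎odd : ∀ n → ∃[ k ] (n ≡ k ℕ.+ k ⊎ n ≡ suc (k ℕ.+ k))
even⊎odd zero = 0 , inj₁ refl
even⊎odd (suc n) with even⊎odd n
... | k , inj₁ refl = k , inj₂ refl
... | k , inj₂ refl = suc k , inj₁ (cong suc (sym (ℕ.+-suc k k)))

<⇒∤ : 0 ℕ.< n → n ℕ.< d → ¬ (+ d ∣ + n)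
<⇒∤ {suc _} _ n<d d∣n = ℕ.>⇒∤ n<d (∣⇒∣ᵤ d∣n)

prime∣*⇒∣⊎∣ : Prime p → + p ∣ i * j → + p ∣ i ⊎ + p ∣ j
prime∣*⇒∣⊎∣ {p} {i} {j} p-prime p∣ij =
  Sum.map ∣ᵤ⇒∣ ∣ᵤ⇒∣ (euclidsLemma ℤ.∣ i ∣ ℤ.∣ j ∣ p-prime (subst (p ℕ.∣_) (ℤ.abs-* i j) (∣⇒∣ᵤ p∣ij)))

prime∣²⇒∣ : Prime p → + p ∣ i * i → + p ∣ i
prime∣²⇒∣ {i = i} p-prime p∣i² = Sum.[ id , id ] (prime∣*⇒∣⊎∣ {i = i} {j = i} p-prime p∣i²)

prime∤1 : Prime p → ¬ (+ p ∣ + 1)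
prime∤1 p-prime p∣1 = ¬prime[1] (subst Prime (ℕ.∣1⇒≡1 (∣⇒∣ᵤ p∣1)) p-prime)

odd-prime∤2 : Prime ℓ → ∀ k → ℓ ≡ suc (k ℕ.+ k) → ¬ (+ ℓ ∣ + 2)
odd-prime∤2 ℓ-prime zero    refl = ⊥-elim (¬prime[1] ℓ-prime)
odd-prime∤2 _       (suc k) refl = <⇒∤ ℕ.z<s (ℕ.s<s (ℕ.s<s (ℕ.<-≤-trans ℕ.z<s (ℕ.m≤n+m (suc k) k))))

-- Fermat's little theorem

prime∤! : Prime p → ∀ m → m ℕ.< p → ¬ (p ℕ.∣ m !)
prime∤! p-prime zero    _   p∣1  = prime∤1 p-prime (∣ᵤ⇒∣ p∣1)
prime∤! p-prime (suc m) m<p p∣m! with euclidsLemma (suc m) (m !) p-prime p∣m!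
... | inj₁ p∣1+m = ℕ.>⇒∤ m<p p∣1+m
... | inj₂ p∣m!  = prime∤! p-prime m (ℕ.<-trans (ℕ.n<1+n m) m<p) p∣m!

prime∣pCk : Prime p → 0 ℕ.< d → d ℕ.< p → p ℕ.∣ p C d
prime∣pCk {p@(suc p-1)} {d} p-prime 0<d d<p
  with euclidsLemma (p C d) (d ! ℕ.* (p ℕ.∸ d) !) p-prime (subst (p ℕ.∣_) (sym C*denominator≡p!) (ℕ.m∣m*n (p-1 !)))
  where
  C*denominator≡p! : (p C d) ℕ.* (d ! ℕ.* (p ℕ.∸ d) !) ≡ p !
  C*denominator≡p! =
    trans (cong (ℕ._* (d ! ℕ.* (p ℕ.∸ d) !)) (nCk≡n!/k![n-k]! (ℕ.<⇒≤ d<p)))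
          (m/n*n≡m {{d !* (p ℕ.∸ d) !≢0}} (k![n∸k]!∣n! (ℕ.<⇒≤ d<p)))
... | inj₁ p∣C = p∣C
... | inj₂ p∣denominator = ⊥-elim (Sum.[ prime∤! p-prime d d<p , prime∤! p-prime (p ℕ.∸ d) (ℕ.∸-monoʳ-< 0<d (ℕ.<⇒≤ d<p)) ]
                                        (euclidsLemma (d !) ((p ℕ.∸ d) !) p-prime p∣denominator))

freshmans-dream : Prime p → ∀ n → ∃[ M ] p ℕ.∣ M × suc n ℕ.^ p ≡ suc (M ℕ.+ n ℕ.^ p)
freshmans-dream {p@(suc (suc p-2))} p-prime n = sum middle , p∣middle , expansion
  where
  term = binomialTerm n 1 p
  middle = init (tail term)

  p∣middle : p ℕ.∣ sum middle
  p∣middle = sum-∣ (suc p-2) middle λ k →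
    let m = suc (toℕ (inject₁ k)) in
    subst (p ℕ.∣_) (sym (×≗* (p C m) _)) (ℕ.∣m⇒∣m*n _ (prime∣pCk p-prime ℕ.z<s
      (ℕ.s<s (subst (ℕ._< suc p-2) (sym (toℕ-inject₁ k)) (toℕ<n k)))))
    where
    ×≗* : ∀ m n → m MonoidMult.× n ≡ m ℕ.* n
    ×≗* zero    n = refl
    ×≗* (suc m) n = cong (n ℕ.+_) (×≗* m n)
    sum-∣ : ∀ {d} k (f : Vector ℕ k) → (∀ i → d ℕ.∣ f i) → d ℕ.∣ sum f
    sum-∣ zero    f d∣f = ℕ._∣0 _
    sum-∣ (suc k) f d∣f = ℕ.∣m∣n⇒∣m+n (d∣f Fin.zero) (sum-∣ k (tail f) (d∣f ∘ Fin.suc))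

  ^≗^ : ∀ x n → x SemiringExp.^ n ≡ x ℕ.^ n
  ^≗^ x zero    = refl
  ^≗^ x (suc n) = cong (x ℕ.*_) (^≗^ x n)

  first : term Fin.zero ≡ 1
  first rewrite ^≗^ 1 p | ℕ.^-zeroˡ p = refl

  last≡n^p : ∀ k → k ≡ p → (p C k) MonoidMult.× (n SemiringExp.^ k ℕ.* 1 SemiringExp.^ (p ℕ.∸ k)) ≡ n ℕ.^ p
  last≡n^p k refl rewrite nCn≡1 p | ℕ.n∸n≡0 p | ^≗^ n p = trans (ℕ.+-identityʳ _) (ℕ.*-identityʳ _)

  expansion : suc n ℕ.^ p ≡ suc (sum middle ℕ.+ n ℕ.^ p)
  expansion = begin
    suc n ℕ.^ p                          ≡⟨ sym (^≗^ (suc n) p) ⟩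
    suc n SemiringExp.^ p                ≡⟨ cong (SemiringExp._^ p) (ℕ.+-comm 1 n) ⟩
    (n ℕ.+ 1) SemiringExp.^ p            ≡⟨ Binomial.theorem p n 1 ⟩
    term Fin.zero ℕ.+ sum (tail term)    ≡⟨ cong₂ ℕ._+_ first (sum-init-last (tail term)) ⟩
    suc (sum middle ℕ.+ tail term (fromℕ (suc p-2)))
                                         ≡⟨ cong (λ t → suc (sum middle ℕ.+ t)) (last≡n^p _ (toℕ-fromℕ _)) ⟩
    suc (sum middle ℕ.+ n ℕ.^ p)         ∎
    where open ≡-Reasoning

fermat-ℕ : Prime p → ∀ n → + p ∣ (+ n) ^ p - + n
fermat-ℕ {suc _} p-prime zero = divides (+ 0) refl
fermat-ℕ {p} p-prime (suc n) with freshmans-dream p-prime n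
... | M , p∣M , expansion = subst (+ p ∣_) regroup (∣m∣n⇒∣m+n (∣ᵤ⇒∣ {i = + M} p∣M) (fermat-ℕ p-prime n))
  where
  open ≡-Reasoning
  expansionℤ : (+ suc n) ^ p ≡ + 1 + (+ M + (+ n) ^ p)
  expansionℤ = begin
    (+ suc n) ^ p               ≡⟨ sym (pos-^ (suc n) p) ⟩
    + (suc n ℕ.^ p)             ≡⟨ cong +_ expansion ⟩
    + 1 + + (M ℕ.+ n ℕ.^ p)     ≡⟨ cong (_+_ (+ 1)) (trans (ℤ.pos-+ M _) (cong (_+_ (+ M)) (pos-^ n p))) ⟩
    + 1 + (+ M + (+ n) ^ p)     ∎
  regroup : + M + ((+ n) ^ p - + n) ≡ (+ suc n) ^ p - + suc n
  regroup = begin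
    + M + ((+ n) ^ p - + n)               ≡⟨ shift (+ M) ((+ n) ^ p) (+ n) ⟩
    + 1 + (+ M + (+ n) ^ p) - (+ 1 + + n) ≡⟨ cong (_- + suc n) (sym expansionℤ) ⟩
    (+ suc n) ^ p - + suc n               ∎
    where
    shift : ∀ M X n → M + (X - n) ≡ + 1 + (M + X) - (+ 1 + n)
    shift = solve-∀

fermat : Prime p → ∀ x → + p ∣ x ^ p - x
fermat {p} p-prime x = subst (+ p ∣_) (telescope x r (x ^ p) (r ^ p))
  (∣m∣n⇒∣m-n (∣m∣n⇒∣m+n (∣-trans p∣x-r (x-y∣xⁿ-yⁿ x r p)) (fermat-ℕ p-prime (x ℤ.% + p))) p∣x-r)
  where
  instance
    _ = prime⇒nonZero p-prime
  r = + (x ℤ.% + p)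
  p∣x-r : + p ∣ x - r
  p∣x-r = divides (x ℤ./ + p) (trans (cong (_- r) (ℤ.a≡a%n+[a/n]*n x (+ p))) (cancel r _))
    where
    cancel : ∀ r t → r + t - r ≡ t
    cancel = solve-∀
  telescope : ∀ x r X R → X - R + (R - r) - (x - r) ≡ X - x
  telescope = solve-∀

fermat-unit : Prime p → ¬ (+ p ∣ x) → + p ∣ x ^ (p ℕ.∸ 1) - + 1
fermat-unit {suc p-1} {x} p-prime p∤x =
  Sum.[ (λ p∣x → ⊥-elim (p∤x p∣x)) , id ]
    (prime∣*⇒∣⊎∣ p-prime (subst (_ ∣_) (factor x (x ^ p-1)) (fermat p-prime x)))
  where
  factor : ∀ x X → x * X - x ≡ x * (X - + 1)
  factor = solve-∀

inverse-mod : Prime p → ¬ (+ p ∣ x) → ∃[ y ] + p ∣ x * y - + 1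
inverse-mod {zero}          p-prime _   = ⊥-elim (¬prime[0] p-prime)
inverse-mod {suc zero}      p-prime _   = ⊥-elim (¬prime[1] p-prime)
inverse-mod {suc (suc p-2)} {x} p-prime p∤x = x ^ p-2 , fermat-unit p-prime p∤x

-- Roots modulo a prime, and -1 as a square

monic : ∀ {d} → Vec ℤ d → ℤ → ℤ
monic []       x = + 1
monic (c ∷ cs) x = c + x * monic cs x

deflate : ∀ {d} → ℤ → Vec ℤ (suc d) → Vec ℤ d
deflate r (c ∷ [])         = []
deflate r (c ∷ cs@(_ ∷ _)) = monic cs r ∷ deflate r cs

monic-deflate : ∀ {d} r (f : Vec ℤ (suc d)) x → monic f x - monic f r ≡ (x - r) * monic (deflate r f) x
monic-deflate r (c ∷ []) x = linear c r x
  where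
  linear : ∀ c r x → c + x * + 1 - (c + r * + 1) ≡ (x - r) * + 1
  linear = solve-∀
monic-deflate r (c ∷ cs@(_ ∷ _)) x = begin
  c + x * g x - (c + r * g r)          ≡⟨ regroup c r x (g x) (g r) ⟩
  x * (g x - g r) + (x - r) * g r      ≡⟨ cong (λ t → x * t + (x - r) * g r) (monic-deflate r cs x) ⟩
  x * ((x - r) * h x) + (x - r) * g r  ≡⟨ factor r x (g r) (h x) ⟩
  (x - r) * (g r + x * h x)            ∎
  where
  open ≡-Reasoning
  g = monic cs
  h = monic (deflate r cs)
  regroup : ∀ c r x G R → c + x * G - (c + r * R) ≡ x * (G - R) + (x - r) * R
  regroup = solve-∀
  factor : ∀ r x R H → x * ((x - r) * H) + (x - r) * R ≡ (x - r) * (R + x * H)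
  factor = solve-∀

monic-replicate-0 : ∀ n x → monic (replicate n (+ 0)) x ≡ x ^ n
monic-replicate-0 zero    x = refl
monic-replicate-0 (suc n) x = trans (ℤ.+-identityˡ _) (cong (x *_) (monic-replicate-0 n x))

Incongruent : ℕ → ℤ → ℤ → Set
Incongruent ℓ r s = ¬ (+ ℓ ∣ s - r)

roots≤degree : Prime ℓ → ∀ {d} (f : Vec ℤ d) {xs : List ℤ} → AllPairs (Incongruent ℓ) xs →
               All (λ x → + ℓ ∣ monic f x) xs → length xs ℕ.≤ d
roots≤degree _       _          []                    _              = ℕ.z≤n
roots≤degree ℓ-prime []         (_ ∷ _)               (ℓ∣1 ∷ _)      = ⊥-elim (prime∤1 ℓ-prime ℓ∣1)
roots≤degree {ℓ} ℓ-prime f@(_ ∷ _) {r ∷ _} (r≉xs ∷ distinct) (ℓ∣fr ∷ ℓ∣fxs) =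
  ℕ.s≤s (roots≤degree ℓ-prime (deflate r f) distinct (All.zipWith root-of-deflate (r≉xs , ℓ∣fxs)))
  where
  root-of-deflate : ∀ {s} → Incongruent ℓ r s × + ℓ ∣ monic f s → + ℓ ∣ monic (deflate r f) s
  root-of-deflate {s} (r≉s , ℓ∣fs) =
    Sum.[ ⊥-elim ∘ r≉s , id ] (prime∣*⇒∣⊎∣ ℓ-prime (subst (_ ∣_) (monic-deflate r f s) (∣m∣n⇒∣m-n ℓ∣fs ℓ∣fr)))

-- x^ℓ - x = (x^(m+1) - x)(x^m + 1), and X^(m+1) - X vanishes at no more than m + 1 of
-- the 2m + 1 residues.
∃x^m≡-1 : Prime ℓ → ∀ m → ℓ ≡ suc (m ℕ.+ m) → ∃[ x ] + ℓ ∣ x ^ m + + 1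
∃x^m≡-1 ℓ-prime zero    refl = ⊥-elim (¬prime[1] ℓ-prime)
∃x^m≡-1 {ℓ} ℓ-prime m@(suc n) refl =
  Sum.[ ⊥-elim ∘ too-many-roots , satisfied ] (All.decide dichotomy (applyUpTo +_ ℓ))
  where
  f : Vec ℤ (suc m)
  f = + 0 ∷ - + 1 ∷ replicate n (+ 0)

  x^ℓ-x≡f*[x^m+1] : ∀ x → x ^ ℓ - x ≡ monic f x * (x ^ m + + 1)
  x^ℓ-x≡f*[x^m+1] x = begin
    x * x ^ (m ℕ.+ m) - x                                ≡⟨ cong (λ t → x * t - x) (ℤ.^-distribˡ-+-* x m m) ⟩
    x * (x * x ^ n * (x * x ^ n)) - x                    ≡⟨ factor x (x ^ n) ⟩
    (+ 0 + x * (- + 1 + x * x ^ n)) * (x * x ^ n + + 1)  ≡⟨ cong (λ t → (+ 0 + x * (- + 1 + x * t)) * (x ^ m + + 1))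
                                                              (sym (monic-replicate-0 n x)) ⟩
    monic f x * (x ^ m + + 1)                            ∎
    where
    open ≡-Reasoning
    factor : ∀ x X → x * (x * X * (x * X)) - x ≡ (+ 0 + x * (- + 1 + x * X)) * (x * X + + 1)
    factor = solve-∀

  dichotomy : ∀ x → + ℓ ∣ monic f x ⊎ + ℓ ∣ x ^ m + + 1
  dichotomy x = prime∣*⇒∣⊎∣ ℓ-prime (subst (_ ∣_) (x^ℓ-x≡f*[x^m+1] x) (fermat ℓ-prime x))

  residues-incongruent : AllPairs (Incongruent ℓ) (applyUpTo +_ ℓ)
  residues-incongruent = applyUpTo⁺₁ +_ ℓ λ {i} {j} i<j j<ℓ ℓ∣j-i →
    <⇒∤ (ℕ.m<n⇒0<n∸m i<j) (ℕ.≤-<-trans (ℕ.m∸n≤m j i) j<ℓ)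
      (subst (_ ∣_) (trans (ℤ.m-n≡m⊖n j i) (ℤ.⊖-≥ (ℕ.<⇒≤ i<j))) ℓ∣j-i)

  too-many-roots : ¬ All (λ x → + ℓ ∣ monic f x) (applyUpTo +_ ℓ)
  too-many-roots all-roots = ℕ.<⇒≱ fewer-roots-than-residues
    (subst (ℕ._≤ suc m) (length-applyUpTo +_ ℓ) (roots≤degree ℓ-prime f residues-incongruent all-roots))
    where
    fewer-roots-than-residues : suc m ℕ.< ℓ
    fewer-roots-than-residues = ℕ.s≤s (ℕ.s≤s (ℕ.m≤n+m m n))

-1-square-mod : Prime ℓ → ∀ K → ℓ ≡ suc ((K ℕ.+ K) ℕ.+ (K ℕ.+ K)) → LegendreMinusOneIsOne ℓ
-1-square-mod {ℓ} ℓ-prime K ℓ≡1+4K with ∃x^m≡-1 ℓ-prime (K ℕ.+ K) ℓ≡1+4K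
... | x , ℓ∣x^2K+1 = x ^ K , ∣⇒∣ᵤ (subst (λ t → + ℓ ∣ t + + 1) (ℤ.^-distribˡ-+-* x K K) ℓ∣x^2K+1)

-1^odd : ∀ K → (- + 1) ^ suc (K ℕ.+ K) ≡ - + 1
-1^odd K = cong (- + 1 *_) (begin
  (- + 1) ^ (K ℕ.+ K)           ≡⟨ ℤ.^-distribˡ-+-* (- + 1) K K ⟩
  (- + 1) ^ K * (- + 1) ^ K     ≡⟨ sym (^-distribʳ-* (- + 1) (- + 1) K) ⟩
  (+ 1) ^ K                     ≡⟨ ℤ.^-zeroˡ K ⟩
  + 1                           ∎)
  where open ≡-Reasoning

-1-nonsquare-mod : Prime ℓ → ∀ K → ℓ ≡ suc (suc (K ℕ.+ K) ℕ.+ suc (K ℕ.+ K)) → ¬ LegendreMinusOneIsOne ℓ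
-1-nonsquare-mod {ℓ} ℓ-prime K refl (x , ℓ∣x²+1) =
  odd-prime∤2 ℓ-prime m refl (subst (_ ∣_) (difference (x ^ (m ℕ.+ m))) (∣m∣n⇒∣m-n ℓ∣x^2m+1 ℓ∣x^2m-1))
  where
  m = suc (K ℕ.+ K)

  ℓ∣x²+1ᶻ : + ℓ ∣ x * x + + 1
  ℓ∣x²+1ᶻ = ∣ᵤ⇒∣ {i = x * x + + 1} ℓ∣x²+1

  ℓ∤x : ¬ (+ ℓ ∣ x)
  ℓ∤x ℓ∣x = prime∤1 ℓ-prime (subst (_ ∣_) (cancel x) (∣m∣n⇒∣m-n ℓ∣x²+1ᶻ (∣m⇒∣m*n x ℓ∣x)))
    where
    cancel : ∀ x → x * x + + 1 - x * x ≡ + 1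
    cancel = solve-∀

  ℓ∣x^2m-1 : + ℓ ∣ x ^ (m ℕ.+ m) - + 1
  ℓ∣x^2m-1 = fermat-unit ℓ-prime ℓ∤x

  ℓ∣x^2m+1 : + ℓ ∣ x ^ (m ℕ.+ m) + + 1
  ℓ∣x^2m+1 = subst (_ ∣_) (cong₂ _-_ x²ᵐ≡x^2m (-1^odd K))
    (∣-trans ℓ∣x²+1ᶻ (x-y∣xⁿ-yⁿ (x * x) (- + 1) m))
    where
    x²ᵐ≡x^2m : (x * x) ^ m ≡ x ^ (m ℕ.+ m)
    x²ᵐ≡x^2m = trans (^-distribʳ-* x x m) (sym (ℤ.^-distribˡ-+-* x m m))

  difference : ∀ X → X + + 1 - (X - + 1) ≡ + 2
  difference = solve-∀

legendre⇔≡1mod4 : Prime ℓ → ∀ k → ℓ ≡ suc (k ℕ.+ k) → LegendreMinusOneIsOne ℓ ⇔ ℓ % 4 ≡ 1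
legendre⇔≡1mod4 {ℓ} ℓ-prime k ℓ≡1+2k with even⊎odd k
... | K , inj₁ refl = mk⇔ (λ _ → ℓ%4≡1) (λ _ → -1-square-mod ℓ-prime K ℓ≡1+2k)
  where
  ℓ%4≡1 : ℓ % 4 ≡ 1
  ℓ%4≡1 = trans (cong (_% 4) (trans ℓ≡1+2k (rearrange K))) ([m+kn]%n≡m%n 1 K 4)
    where
    rearrange : ∀ K → suc ((K ℕ.+ K) ℕ.+ (K ℕ.+ K)) ≡ 1 ℕ.+ K ℕ.* 4
    rearrange = ℕ-Solver.solve-∀
... | K , inj₂ refl = mk⇔ (⊥-elim ∘ -1-nonsquare-mod ℓ-prime K ℓ≡1+2k) (λ ℓ%4≡1 → ⊥-elim (3≢1 (trans (sym ℓ%4≡3) ℓ%4≡1)))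
  where
  ℓ%4≡3 : ℓ % 4 ≡ 3
  ℓ%4≡3 = trans (cong (_% 4) (trans ℓ≡1+2k (rearrange K))) ([m+kn]%n≡m%n 3 K 4)
    where
    rearrange : ∀ K → suc (suc (K ℕ.+ K) ℕ.+ suc (K ℕ.+ K)) ≡ 3 ℕ.+ K ℕ.* 4
    rearrange = ℕ-Solver.solve-∀
  3≢1 : 3 ≢ 1
  3≢1 ()

-- Hensel lifting

-- Newton's step z - (z² + 1)/(2z), using 1/z ≡ -z and 1/2 ≡ h.  An inverse of 2 modulo v
-- suffices at every level, since each step has to gain only one factor v.
hensel-step : ∀ v h → + 2 * h ≡ v + + 1 → ∀ n z → v ^ suc n ∣ z * z + + 1 →
              ∃[ z′ ] v ^ suc (suc n) ∣ z′ * z′ + + 1 × v ^ suc n ∣ z′ - z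
hensel-step v h 2h≡v+1 n z (divides E z²+1≡Evⁿ⁺¹) =
  z + E * (v * U) * z * h , divides E′ z′²+1≡E′vⁿ⁺² , divides (E * z * h) (step v U E z h)
  where
  open ≡-Reasoning
  U = v ^ n
  E′ = E * E * U + E * z * z + E * E * U * z * z * h * h

  z′²+1≡E′vⁿ⁺² : (z + E * (v * U) * z * h) * (z + E * (v * U) * z * h) + + 1 ≡ E′ * (v * (v * U))
  z′²+1≡E′vⁿ⁺² = begin
    (z + E * (v * U) * z * h) * (z + E * (v * U) * z * h) + + 1
      ≡⟨ expand v U E z h ⟩
    E′ * (v * (v * U)) + (z * z + + 1 - E * (v * U)) * (+ 1 + E * (v * U)) + E * (v * U) * z * z * (+ 2 * h - (v + + 1))
      ≡⟨ cong₂ (λ s t → E′ * (v * (v * U)) + s * (+ 1 + E * (v * U)) + E * (v * U) * z * z * t)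
               (ℤ.i≡j⇒i-j≡0 z²+1≡Evⁿ⁺¹) (ℤ.i≡j⇒i-j≡0 2h≡v+1) ⟩
    E′ * (v * (v * U)) + + 0 * (+ 1 + E * (v * U)) + E * (v * U) * z * z * + 0
      ≡⟨ drop (E′ * (v * (v * U))) (+ 1 + E * (v * U)) (E * (v * U) * z * z) ⟩
    E′ * (v * (v * U))
      ∎
    where
    expand : ∀ v U E z h →
      (z + E * (v * U) * z * h) * (z + E * (v * U) * z * h) + + 1
      ≡ (E * E * U + E * z * z + E * E * U * z * z * h * h) * (v * (v * U))
        + (z * z + + 1 - E * (v * U)) * (+ 1 + E * (v * U)) + E * (v * U) * z * z * (+ 2 * h - (v + + 1))
    expand = solve-∀
    drop : ∀ a b c → a + + 0 * b + c * + 0 ≡ a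
    drop = solve-∀

  step : ∀ v U E z h → z + E * (v * U) * z * h - z ≡ E * z * h * (v * U)
  step = solve-∀

module HenselLift (v h : ℤ) (2h≡v+1 : + 2 * h ≡ v + + 1) (z₀ : ℤ) (v∣z₀²+1 : v ∣ z₀ * z₀ + + 1) where

  lift : ∀ n → ∃[ z ] v ^ suc n ∣ z * z + + 1
  lift zero    = z₀ , subst (_∣ _) (sym (ℤ.*-identityʳ v)) v∣z₀²+1
  lift (suc n) = map₂ proj₁ (hensel-step v h 2h≡v+1 n (proj₁ (lift n)) (proj₂ (lift n)))

  lift-coherent : ∀ n → v ^ suc n ∣ proj₁ (lift (suc n)) - proj₁ (lift n)
  lift-coherent n = proj₂ (proj₂ (hensel-step v h 2h≡v+1 n (proj₁ (lift n)) (proj₂ (lift n))))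

xⁿ∣x¹⁺ⁿ : ∀ x n → x ^ n ∣ x ^ suc n
xⁿ∣x¹⁺ⁿ x n = divides x refl

curveDefect-at-x=0 : ∀ p q v Y → curveDefect p q v 0 0 (+ 0) Y ≡ Y * Y + + 4
curveDefect-at-x=0 p q v Y = unfolded (+ (2 ℕ.* (p ℕ.+ q))) Y
  where
  unfolded : ∀ c Y → Y * (Y * + 1) * + 1 - (- (+ 0 * (+ 0 * (+ 0 * (+ 0 * + 1))) * + 1)
                       + c * (+ 0 * (+ 0 * + 1)) * + 1 - + 4 * + 1) ≡ Y * Y + + 4
  unfolded = solve-∀

legendre⇒curve : ∀ p q {v} k → v ≡ suc (k ℕ.+ k) → LegendreMinusOneIsOne v → CurveHasQvPoint p q v
legendre⇒curve p q {v} k refl (i , v∣i²+1) = origin , Y , 0 , 0 , on-curve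
  where
  halve : ∀ k → 2 ℕ.* suc k ≡ suc (k ℕ.+ k) ℕ.+ 1
  halve = ℕ-Solver.solve-∀

  open HenselLift (+ v) (+ suc k) (cong +_ (halve k)) i (∣ᵤ⇒∣ {i = i * i + + 1} v∣i²+1)

  z : ℕ → ℤ
  z n = proj₁ (lift n)

  origin : ℤₚ v
  origin = mkℤₚ (λ _ → + 0) (λ n → ℕ._∣0 _)

  Y : ℤₚ v
  Y = mkℤₚ (λ n → + 2 * z n) λ n → ∣⇒∣ᵤ-^ v n (subst (_ ∣_) (distrib (z (suc n)) (z n))
        (∣n⇒∣m*n (+ 2) (∣-trans (xⁿ∣x¹⁺ⁿ (+ v) n) (lift-coherent n))))
    where
    distrib : ∀ a b → + 2 * (a - b) ≡ + 2 * a - + 2 * b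
    distrib = solve-∀

  on-curve : ∀ n → + (v ℕ.^ n) Unsigned.∣ curveDefect p q v 0 0 (+ 0) (+ 2 * z n)
  on-curve n = ∣⇒∣ᵤ-^ v n (subst (_ ∣_) (trans (quadruple (z n)) (sym (curveDefect-at-x=0 p q v (+ 2 * z n))))
    (∣n⇒∣m*n (+ 4) (∣-trans (xⁿ∣x¹⁺ⁿ (+ v) n) (proj₂ (lift n)))))
    where
    quadruple : ∀ z → + 4 * (z * z + + 1) ≡ + 2 * z * (+ 2 * z) + + 4
    quadruple = solve-∀

-- Descent

-- If p ∤ b, then a/b is a square root of -1 modulo p.
prime∣sum-of-squares : Prime p → ∀ a b → + p ∣ a * a + b * b → LegendreMinusOneIsOne p ⊎ (+ p ∣ a × + p ∣ b)
prime∣sum-of-squares {p} p-prime a b p∣a²+b² with + p ∣? b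
... | yes p∣b = inj₂ (prime∣²⇒∣ p-prime (subst (_ ∣_) (cancel a b) (∣m∣n⇒∣m-n p∣a²+b² (∣m⇒∣m*n b p∣b))) , p∣b)
  where
  cancel : ∀ a b → a * a + b * b - b * b ≡ a * a
  cancel = solve-∀
... | no p∤b with inverse-mod p-prime p∤b
...   | b⁻¹ , p∣bb⁻¹-1 = inj₁ (b⁻¹ * a , ∣⇒∣ᵤ (subst (_ ∣_) (sym (complete b⁻¹ a b))
          (∣m∣n⇒∣m-n (∣n⇒∣m*n (b⁻¹ * b⁻¹) p∣a²+b²) (∣m⇒∣m*n (b * b⁻¹ + + 1) p∣bb⁻¹-1))))
  where
  complete : ∀ u a b → u * a * (u * a) + + 1 ≡ u * u * (a * a + b * b) - (b * u - + 1) * (b * u + + 1)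
  complete = solve-∀

ternaryForm : ℤ → ℤ → ℤ → ℤ → ℤ
ternaryForm d a b c = a * a + b * b - d * (c * c)

∣⇒²∣² : i ∣ j → i * i ∣ j * j
∣⇒²∣² {i} {j} i∣j = ∣-trans (*-monoʳ-∣ i i∣j) (*-monoˡ-∣ j i∣j)

descent-step : Prime p → ¬ (+ p ∣ x) → ∀ a b c → + p * + p ∣ ternaryForm (+ p * x) a b c →
               LegendreMinusOneIsOne p ⊎ (+ p ∣ a × + p ∣ b × + p ∣ c)
descent-step {p} {x} p-prime p∤x a b c p²∣F
  with prime∣sum-of-squares p-prime a b (subst (_ ∣_) (add-back (+ p * x) a b c)
         (∣m∣n⇒∣m+n (∣-trans (divides (+ p) refl) p²∣F) (∣m⇒∣m*n (c * c) (∣m⇒∣m*n x ∣-refl))))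
  where
  add-back : ∀ d a b c → a * a + b * b - d * (c * c) + d * (c * c) ≡ a * a + b * b
  add-back = solve-∀
... | inj₁ -1-square   = inj₁ -1-square
... | inj₂ (p∣a , p∣b) = inj₂ (p∣a , p∣b , p∣c)
  where
  instance
    _ = prime⇒nonZero p-prime
  p²∣pxc² : + p * + p ∣ + p * (x * (c * c))
  p²∣pxc² = subst (_ ∣_) (difference (+ p) x a b c)
    (∣m∣n⇒∣m-n (∣m∣n⇒∣m+n (∣⇒²∣² p∣a) (∣⇒²∣² p∣b)) p²∣F)
    where
    difference : ∀ p x a b c → a * a + b * b - (a * a + b * b - p * x * (c * c)) ≡ p * (x * (c * c))
    difference = solve-∀
  p∣c : + p ∣ c
  p∣c = Sum.[ ⊥-elim ∘ p∤x , prime∣²⇒∣ p-prime ] (prime∣*⇒∣⊎∣ p-prime (*-cancelˡ-∣ (+ p) p²∣pxc²))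

x^[2+2j]≡x²x^2j : ∀ x j → x ^ (suc j ℕ.+ suc j) ≡ x * x * x ^ (j ℕ.+ j)
x^[2+2j]≡x²x^2j x j = trans (cong (λ n → x * x ^ n) (ℕ.+-suc j j)) (sym (ℤ.*-assoc x x _))

x²∣x^[2+2j] : ∀ x j → x * x ∣ x ^ (suc j ℕ.+ suc j)
x²∣x^[2+2j] x j = divides (x ^ (j ℕ.+ j)) (trans (x^[2+2j]≡x²x^2j x j) (ℤ.*-comm (x * x) (x ^ (j ℕ.+ j))))

ternaryForm-scale : ∀ d a b c x → ternaryForm d (a * x) (b * x) (c * x) ≡ x * x * ternaryForm d a b c
ternaryForm-scale d a b c x = expand d a b c x
  where
  expand : ∀ d a b c x → a * x * (a * x) + b * x * (b * x) - d * (c * x * (c * x))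
                         ≡ x * x * (a * a + b * b - d * (c * c))
  expand = solve-∀

descent : Prime p → ¬ (+ p ∣ x) → ∀ j a b c → (+ p) ^ (j ℕ.+ j) ∣ ternaryForm (+ p * x) a b c →
          LegendreMinusOneIsOne p ⊎ ((+ p) ^ j ∣ a × (+ p) ^ j ∣ b × (+ p) ^ j ∣ c)
descent p-prime p∤x zero a b c _ = inj₂ (1∣ a , 1∣ b , 1∣ c)
  where
  1∣ : ∀ i → + 1 ∣ i
  1∣ i = divides i (sym (ℤ.*-identityʳ i))
descent {p} {x} p-prime p∤x (suc j) a b c pᴺ∣F
  with descent-step p-prime p∤x a b c (∣-trans (x²∣x^[2+2j] (+ p) j) pᴺ∣F)
... | inj₁ -1-square = inj₁ -1-square
... | inj₂ (divides a′ refl , divides b′ refl , divides c′ refl) =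
  Sum.map₂ (λ (pʲ∣a′ , pʲ∣b′ , pʲ∣c′) → raise pʲ∣a′ , raise pʲ∣b′ , raise pʲ∣c′)
    (descent p-prime p∤x j a′ b′ c′ (*-cancelˡ-∣ (+ p * + p) {{ℤ.i*j≢0 (+ p) (+ p)}}
      (subst₂ _∣_ (x^[2+2j]≡x²x^2j (+ p) j) (ternaryForm-scale (+ p * x) a′ b′ c′ (+ p)) pᴺ∣F)))
  where
  instance
    _ = prime⇒nonZero p-prime
  raise : ∀ {i} → (+ p) ^ j ∣ i → (+ p) ^ suc j ∣ i * + p
  raise {i} pʲ∣i = subst (_ ∣_) (ℤ.*-comm (+ p) i) (*-monoʳ-∣ (+ p) pʲ∣i)

-- With P = vᵃ and Q = vᵇ, clearing denominators of (X/vᵃ, Y/vᵇ) in y² = -x⁴ + (4ε + 4v)x² - 4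
-- turns the curve into (Y P²)² + ((X² - 2εP²) Q)² = 4v (X P Q)².
curve-as-ternaryForm : ∀ {c T₁ T₂ T₃ T₄} X Y P Q ε v → ε * ε ≡ + 1 → c ≡ + 4 * ε + + 4 * v →
  T₁ ≡ P * P * (P * P) → T₂ ≡ Q * Q → T₃ ≡ P * P * (Q * Q) → T₄ ≡ P * P * (P * P) * (Q * Q) →
  Y * (Y * + 1) * T₁ - (- (X * (X * (X * (X * + 1))) * T₂) + c * (X * (X * + 1)) * T₃ - + 4 * T₄)
  ≡ ternaryForm (v * + 4) (Y * (P * P)) ((X * X - + 2 * ε * (P * P)) * Q) (X * (P * Q))
curve-as-ternaryForm X Y P Q ε v ε²≡1 refl refl refl refl refl = begin
  _                               ≡⟨ expand X Y P Q ε v ⟩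
  F + P⁴Q² * (+ 4 - + 4 * (ε * ε)) ≡⟨ cong (λ t → F + P⁴Q² * (+ 4 - + 4 * t)) ε²≡1 ⟩
  F + P⁴Q² * + 0                   ≡⟨ cong (_+_ F) (ℤ.*-zeroʳ P⁴Q²) ⟩
  F + + 0                          ≡⟨ ℤ.+-identityʳ F ⟩
  F                                ∎
  where
  open ≡-Reasoning
  F = ternaryForm (v * + 4) (Y * (P * P)) ((X * X - + 2 * ε * (P * P)) * Q) (X * (P * Q))
  P⁴Q² = P * P * (P * P) * (Q * Q)
  expand : ∀ X Y P Q ε v →
    Y * (Y * + 1) * (P * P * (P * P))
      - (- (X * (X * (X * (X * + 1))) * (Q * Q)) + (+ 4 * ε + + 4 * v) * (X * (X * + 1)) * (P * P * (Q * Q))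
         - + 4 * (P * P * (P * P) * (Q * Q)))
    ≡ (Y * (P * P) * (Y * (P * P)) + (X * X - + 2 * ε * (P * P)) * Q * ((X * X - + 2 * ε * (P * P)) * Q)
         - v * + 4 * (X * (P * Q) * (X * (P * Q))))
      + P * P * (P * P) * (Q * Q) * (+ 4 - + 4 * (ε * ε))
  expand = solve-∀

^ᶻ≗^ : ∀ x n → x ^ᶻ n ≡ x ^ n
^ᶻ≗^ x zero    = refl
^ᶻ≗^ x (suc n) = cong (x *_) (^ᶻ≗^ x n)

^ᶻ-double : ∀ x a → x ^ᶻ (2 ℕ.* a) ≡ x ^ a * x ^ a
^ᶻ-double x a = trans (^ᶻ≗^ x (2 ℕ.* a)) (trans (cong (x ^_) (double a)) (ℤ.^-distribˡ-+-* x a a))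
  where
  double : ∀ a → 2 ℕ.* a ≡ a ℕ.+ a
  double = ℕ-Solver.solve-∀

^ᶻ-+ : ∀ x a b → x ^ᶻ (a ℕ.+ b) ≡ x ^ᶻ a * x ^ᶻ b
^ᶻ-+ x a b = trans (^ᶻ≗^ x (a ℕ.+ b)) (trans (ℤ.^-distribˡ-+-* x a b) (sym (cong₂ _*_ (^ᶻ≗^ x a) (^ᶻ≗^ x b))))

^ᶻ-quadruple : ∀ x a → x ^ᶻ (4 ℕ.* a) ≡ x ^ a * x ^ a * (x ^ a * x ^ a)
^ᶻ-quadruple x a = begin
  x ^ᶻ (4 ℕ.* a)                        ≡⟨ cong (x ^ᶻ_) (split a) ⟩
  x ^ᶻ (2 ℕ.* a ℕ.+ 2 ℕ.* a)            ≡⟨ ^ᶻ-+ x (2 ℕ.* a) (2 ℕ.* a) ⟩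
  x ^ᶻ (2 ℕ.* a) * x ^ᶻ (2 ℕ.* a)       ≡⟨ cong₂ _*_ (^ᶻ-double x a) (^ᶻ-double x a) ⟩
  x ^ a * x ^ a * (x ^ a * x ^ a)       ∎
  where
  open ≡-Reasoning
  split : ∀ a → 4 ℕ.* a ≡ 2 ℕ.* a ℕ.+ 2 ℕ.* a
  split = ℕ-Solver.solve-∀

curveDefect≡ternaryForm : ∀ p q v a b X Y ε → ε * ε ≡ + 1 → + (2 ℕ.* (p ℕ.+ q)) ≡ + 4 * ε + + 4 * + v →
  let P = (+ v) ^ a; Q = (+ v) ^ b in
  curveDefect p q v a b X Y ≡ ternaryForm (+ v * + 4) (Y * (P * P)) ((X * X - + 2 * ε * (P * P)) * Q) (X * (P * Q))
curveDefect≡ternaryForm p q v a b X Y ε ε²≡1 c≡ =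
  curve-as-ternaryForm X Y ((+ v) ^ a) ((+ v) ^ b) ε (+ v) ε²≡1 c≡ (^ᶻ-quadruple (+ v) a) (^ᶻ-double (+ v) b)
    (trans (^ᶻ-+ (+ v) (2 ℕ.* a) (2 ℕ.* b)) (cong₂ _*_ (^ᶻ-double (+ v) a) (^ᶻ-double (+ v) b)))
    (trans (^ᶻ-+ (+ v) (4 ℕ.* a) (2 ℕ.* b)) (cong₂ _*_ (^ᶻ-quadruple (+ v) a) (^ᶻ-double (+ v) b)))

¬deeply-divisible : ¬ (+ p ∣ + 2) → ∀ ε X P Q .{{_ : NonZero P}} .{{_ : NonZero Q}} → ε * ε ≡ + 1 →
  + p * (P * P * Q) ∣ (X * X - + 2 * ε * (P * P)) * Q → ¬ (+ p * (P * P * Q) ∣ X * (P * Q))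
¬deeply-divisible {p} p∤2 ε X P Q ε²≡1 B-divisible C-divisible =
  p∤2 (subst (_ ∣_) 2εε≡2 (∣m⇒∣m*n ε (*-cancelʳ-∣ (P * P) {+ p} {+ 2 * ε} {{ℤ.i*j≢0 P P}} pP²∣2εP²)))
  where
  pP∣X : + p * P ∣ X
  pP∣X = *-cancelʳ-∣ (P * Q) {{ℤ.i*j≢0 P Q}} (subst (_∣ _) (regroup (+ p) P Q) C-divisible)
    where
    regroup : ∀ p P Q → p * (P * P * Q) ≡ p * P * (P * Q)
    regroup = solve-∀

  pP²∣X² : + p * (P * P) ∣ X * X
  pP²∣X² = ∣-trans (divides (+ p) (regroup (+ p) P)) (∣⇒²∣² pP∣X)
    where
    regroup : ∀ p P → p * P * (p * P) ≡ p * (p * (P * P))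
    regroup = solve-∀

  pP²∣X²-2εP² : + p * (P * P) ∣ X * X - + 2 * ε * (P * P)
  pP²∣X²-2εP² = *-cancelʳ-∣ Q (subst (_∣ _) (regroup (+ p) P Q) B-divisible)
    where
    regroup : ∀ p P Q → p * (P * P * Q) ≡ p * (P * P) * Q
    regroup = solve-∀

  pP²∣2εP² : + p * (P * P) ∣ + 2 * ε * (P * P)
  pP²∣2εP² = subst (_ ∣_) (difference X (+ 2 * ε * (P * P))) (∣m∣n⇒∣m-n pP²∣X² pP²∣X²-2εP²)
    where
    difference : ∀ X T → X * X - (X * X - T) ≡ T
    difference = solve-∀

  2εε≡2 : + 2 * ε * ε ≡ + 2
  2εε≡2 = trans (ℤ.*-assoc (+ 2) ε ε) (cong (+ 2 *_) ε²≡1)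

curve⇒legendre : ∀ p q {v} k ε → Prime v → v ≡ suc (k ℕ.+ k) → ε * ε ≡ + 1 →
                 + (2 ℕ.* (p ℕ.+ q)) ≡ + 4 * ε + + 4 * + v → CurveHasQvPoint p q v → LegendreMinusOneIsOne v
curve⇒legendre p q {v} k ε v-prime v-odd ε²≡1 c≡ (X , Y , a , b , on-curve) =
  Sum.[ id , (λ (_ , vᵈ∣β , vᵈ∣γ) → ⊥-elim (¬deeply-divisible v∤2 ε xᴺ P Q ε²≡1
                                      (subst (_∣ β) vᵈ≡vP²Q vᵈ∣β) (subst (_∣ γ) vᵈ≡vP²Q vᵈ∣γ))) ]
    (descent v-prime v∤4 depth α β γ vᴺ∣form)
  where
  P = (+ v) ^ a
  Q = (+ v) ^ b
  instance
    _ = prime⇒nonZero v-prime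
    _ = ^-nonZero (+ v) a
    _ = ^-nonZero (+ v) b

  v∤2 : ¬ (+ v ∣ + 2)
  v∤2 = odd-prime∤2 v-prime k v-odd

  v∤4 : ¬ (+ v ∣ + 4)
  v∤4 = v∤2 ∘ prime∣²⇒∣ {i = + 2} v-prime

  -- one factor v more than the denominators P² Q can absorb
  depth = suc (a ℕ.+ a ℕ.+ b)
  xᴺ = seq X (depth ℕ.+ depth)
  yᴺ = seq Y (depth ℕ.+ depth)
  α = yᴺ * (P * P)
  β = (xᴺ * xᴺ - + 2 * ε * (P * P)) * Q
  γ = xᴺ * (P * Q)

  vᴺ∣form : (+ v) ^ (depth ℕ.+ depth) ∣ ternaryForm (+ v * + 4) α β γ
  vᴺ∣form = subst ((+ v) ^ (depth ℕ.+ depth) ∣_) (curveDefect≡ternaryForm p q v a b xᴺ yᴺ ε ε²≡1 c≡)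
    (∣ᵤ⇒∣-^ v (depth ℕ.+ depth) (on-curve (depth ℕ.+ depth)))

  vᵈ≡vP²Q : (+ v) ^ depth ≡ + v * (P * P * Q)
  vᵈ≡vP²Q = cong (+ v *_) (trans (ℤ.^-distribˡ-+-* (+ v) (a ℕ.+ a) b) (cong (_* Q) (ℤ.^-distribˡ-+-* (+ v) a a)))

curve⇔legendre : ∀ p q {v} k ε → Prime v → v ≡ suc (k ℕ.+ k) → ε * ε ≡ + 1 →
                 + (2 ℕ.* (p ℕ.+ q)) ≡ + 4 * ε + + 4 * + v → CurveHasQvPoint p q v ⇔ LegendreMinusOneIsOne v
curve⇔legendre p q k ε v-prime v-odd ε²≡1 c≡ =
  mk⇔ (curve⇒legendre p q k ε v-prime v-odd ε²≡1 c≡) (legendre⇒curve p q k v-odd)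

2[p+q]≡4+4p : ∀ p → + (2 ℕ.* (p ℕ.+ (p ℕ.+ 2))) ≡ + 4 * + 1 + + 4 * + p
2[p+q]≡4+4p p = trans (cong +_ (expand p)) (trans (ℤ.pos-+ 4 (4 ℕ.* p)) (cong (_+_ (+ 4)) (ℤ.pos-* 4 p)))
  where
  expand : ∀ p → 2 ℕ.* (p ℕ.+ (p ℕ.+ 2)) ≡ 4 ℕ.+ 4 ℕ.* p
  expand = ℕ-Solver.solve-∀

2[p+q]≡-4+4q : ∀ p → + (2 ℕ.* (p ℕ.+ (p ℕ.+ 2))) ≡ + 4 * - + 1 + + 4 * + (p ℕ.+ 2)
2[p+q]≡-4+4q p = trans (2[p+q]≡4+4p p) (shift (+ p))
  where
  shift : ∀ P → + 4 * + 1 + + 4 * P ≡ + 4 * - + 1 + + 4 * (P + + 2)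
  shift = solve-∀

twin-prime-odd : Prime p → Prime (p ℕ.+ 2) → ∃[ k ] p ≡ suc (k ℕ.+ k)
twin-prime-odd {p} p-prime p+2-prime with even⊎odd p
... | k , inj₂ p-odd  = k , p-odd
... | k , inj₁ p-even with prime⇒irreducible p-prime (ℕ.divides k (trans p-even (double k)))
  where
  double : ∀ k → k ℕ.+ k ≡ k ℕ.* 2
  double = ℕ-Solver.solve-∀
...   | inj₁ ()
...   | inj₂ refl = ⊥-elim (prime⇒¬composite p+2-prime composite[4])

proposition3p8 : (p q : ℕ) → Prime p → Prime q → q ≡ p ℕ.+ 2 →
    ((CurveHasQvPoint p q p ⇔ LegendreMinusOneIsOne p)
      × (LegendreMinusOneIsOne p ⇔ p % 4 ≡ 1))
    × ((CurveHasQvPoint p q q ⇔ LegendreMinusOneIsOne q)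
      × (LegendreMinusOneIsOne q ⇔ q % 4 ≡ 1))
proposition3p8 p q p-prime q-prime refl with twin-prime-odd p-prime q-prime
... | k , p≡1+2k =
  (curve⇔legendre p q k (+ 1) p-prime p≡1+2k refl (2[p+q]≡4+4p p) , legendre⇔≡1mod4 p-prime k p≡1+2k) ,
  (curve⇔legendre p q (suc k) (- + 1) q-prime q≡1+2[1+k] refl (2[p+q]≡-4+4q p) , legendre⇔≡1mod4 q-prime (suc k) q≡1+2[1+k])
  where
  q≡1+2[1+k] : p ℕ.+ 2 ≡ suc (suc k ℕ.+ suc k)
  q≡1+2[1+k] = trans (cong (ℕ._+ 2) p≡1+2k) (shift k)
    where
    shift : ∀ k → suc (k ℕ.+ k) ℕ.+ 2 ≡ suc (suc k ℕ.+ suc k)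
    shift = ℕ-Solver.solve-∀
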